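{- If $n$ is a near superperfect positive integer, then $$\sigma(n)\le 3n-\frac{\sqrt{12n+1}-1}{2}.$$
   Context: $\sigma(m)$ denotes the sum of the positive divisors of $m$. A positive integer $n$ is near superperfect if $2n+d=\sigma(\sigma(n))$ for some positive divisor $d$ of $n$. -}

module Defs where

open import Data.Nat using (ℕ; suc; _+_; _*_; _<_)
open import Data.Nat.Divisibility using (_∣_; _∣?_)
open import Data.List using (List; filter; map; upTo)
open import Data.Nat.ListAction using (sum)
open import Data.Product using (∃-syntax; _×_)
open import Relation.Binary.PropositionalEquality using (_≡_)

divisors : ℕ → List ℕ
divisors m = filter (_∣? m) (map suc (upTo m))

σ : ℕ → ℕ
σ m = sum (divisors m)

NearSuperperfect : ℕ → Set
NearSuperperfect n = ∃[ d ] (0 < d × d ∣ n × 2 * n + d ≡ σ (σ n))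

-- Let m = σ(n), so that σ(m) = 2n + d ≤ 3n. If m were prime, n would be a prime power
-- (σ is multiplicative), hence deficient, and σ(m) = m + 1 ≤ 2n < 2n + d. So m is composite,
-- m = bc with 1 < b, c < m, and 1 + b + m ≤ σ(m) ≤ 3n gives b, c < k := 3n − m. Hence
-- 3n − k = m ≤ k², which is 12n + 1 ≤ (2k + 1)².
module Submission where

open import Defs
open import Level using (Level)
open import Data.Nat
open import Data.Nat.Properties
open import Data.Nat.Divisibility
open import Data.Nat.Coprimality using (Coprime; coprime-divisor)
open import Data.Nat.Primality
  using (Prime; Composite; prime⇒nonZero; prime⇒nonTrivial; prime⇒irreducible; composite⇒¬prime; ¬prime⇒composite)
open import Data.Nat.Primality.Factorisation using (factorise)
open import Data.Nat.Induction using (<-wellFounded)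
open import Data.Nat.ListAction using (sum; product)
open import Data.Nat.Tactic.RingSolver using (solve-∀)
open import Data.List using ([]; _∷_; filter; map; upTo; applyUpTo)
open import Data.List.Properties using (map-upTo; map-applyUpTo)
open import Data.List.Relation.Unary.All using (All)
open import Algebra.Properties.CommutativeSemigroup +-commutativeSemigroup using (interchange)
open import Algebra.Properties.CommutativeSemigroup *-commutativeSemigroup using (x∙yz≈y∙xz)
open import Data.Product using (_×_; _,_; proj₁; proj₂; ∃-syntax)
open import Data.Sum using (inj₁; inj₂)
open import Function using (_∘_; flip)
open import Induction.WellFounded using (Acc; acc)
open import Relation.Nullary using (Dec; yes; no; ¬_; ¬?; _×-dec_; contradiction)
open import Relation.Unary using (Pred; Decidable)
open import Relation.Binary.PropositionalEquality

private
  variable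
    a b p : Level
    A : Set a
    B : Set b

∑< : ℕ → (ℕ → ℕ) → ℕ
∑< n f = sum (applyUpTo f n)

syntax ∑< n (λ i → x) = ∑[ i < n ] x

∑-cong : ∀ n {f g : ℕ → ℕ} → (∀ i → f i ≡ g i) → ∑[ i < n ] f i ≡ ∑[ i < n ] g i
∑-cong zero    f≗g = refl
∑-cong (suc n) f≗g = cong₂ _+_ (f≗g 0) (∑-cong n (f≗g ∘ suc))

∑-zero : ∀ n {f : ℕ → ℕ} → (∀ {i} → i < n → f i ≡ 0) → ∑[ i < n ] f i ≡ 0
∑-zero zero    f≡0 = refl
∑-zero (suc n) f≡0 = cong₂ _+_ (f≡0 z<s) (∑-zero n (f≡0 ∘ s<s))

∑-distrib-+ : ∀ n (f g : ℕ → ℕ) → ∑[ i < n ] (f i + g i) ≡ ∑[ i < n ] f i + ∑[ i < n ] g i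
∑-distrib-+ zero    f g = refl
∑-distrib-+ (suc n) f g = trans (cong (f 0 + g 0 +_) (∑-distrib-+ n (f ∘ suc) (g ∘ suc)))
                                (interchange (f 0) (g 0) _ _)

*-distribˡ-∑ : ∀ n q (f : ℕ → ℕ) → q * ∑[ i < n ] f i ≡ ∑[ i < n ] (q * f i)
*-distribˡ-∑ zero    q f = *-zeroʳ q
*-distribˡ-∑ (suc n) q f = trans (*-distribˡ-+ q (f 0) _) (cong (q * f 0 +_) (*-distribˡ-∑ n q (f ∘ suc)))

∑-+ : ∀ m n (f : ℕ → ℕ) → ∑[ i < m + n ] f i ≡ ∑[ i < m ] f i + ∑[ j < n ] f (m + j)
∑-+ zero    n f = refl
∑-+ (suc m) n f = trans (cong (f 0 +_) (∑-+ m n (f ∘ suc))) (sym (+-assoc (f 0) _ _))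

∑-vanishing-tail : ∀ {m n} {f : ℕ → ℕ} → (∀ {i} → m ≤ i → f i ≡ 0) → m ≤ n →
                   ∑[ i < n ] f i ≡ ∑[ i < m ] f i
∑-vanishing-tail {m} {n} {f} f≡0 m≤n = begin
  ∑[ i < n ] f i                                  ≡⟨ cong (λ k → ∑[ i < k ] f i) (m+[n∸m]≡n m≤n) ⟨
  ∑[ i < m + (n ∸ m) ] f i                        ≡⟨ ∑-+ m (n ∸ m) f ⟩
  ∑[ i < m ] f i + ∑[ j < n ∸ m ] f (m + j)       ≡⟨ cong (∑[ i < m ] f i +_) (∑-zero (n ∸ m) (λ _ → f≡0 (m≤m+n m _))) ⟩
  ∑[ i < m ] f i + 0                              ≡⟨ +-identityʳ _ ⟩
  ∑[ i < m ] f i                                  ∎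
  where open ≡-Reasoning

∑-multiples : ∀ b q .{{_ : NonZero q}} {f : ℕ → ℕ} → (∀ {i} → ¬ q ∣ i → f i ≡ 0) →
              ∑[ i < b * q ] f i ≡ ∑[ j < b ] f (j * q)
∑-multiples zero    q f≡0 = refl
∑-multiples (suc b) q@(suc p) {f} f≡0 = begin
  ∑[ i < q + b * q ] f i                            ≡⟨ ∑-+ q (b * q) f ⟩
  ∑[ i < q ] f i + ∑[ j < b * q ] f (q + j)         ≡⟨ cong₂ _+_ first-block (∑-multiples b q (f≡0 ∘ ∤-shift)) ⟩
  f 0 + ∑[ j < b ] f (suc j * q)                    ∎
  where
  open ≡-Reasoning
  ∤-shift : ∀ {j} → ¬ q ∣ j → ¬ q ∣ q + j
  ∤-shift q∤j q∣q+j = q∤j (∣m+n∣m⇒∣n q∣q+j ∣-refl)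
  first-block : ∑[ i < q ] f i ≡ f 0
  first-block = trans (cong (f 0 +_) (∑-zero p (λ i<p → f≡0 (>⇒∤ (s<s i<p))))) (+-identityʳ (f 0))

∑-≥-term : ∀ {i n} (f : ℕ → ℕ) → i < n → f i ≤ ∑[ k < n ] f k
∑-≥-term {zero}  {suc n} f _         = m≤m+n (f 0) _
∑-≥-term {suc i} {suc n} f (s<s i<n) = ≤-trans (∑-≥-term (f ∘ suc) i<n) (m≤n+m _ (f 0))

∑-≥-pair : ∀ {i j n} (f : ℕ → ℕ) → i < j → j < n → f i + f j ≤ ∑[ k < n ] f k
∑-≥-pair {zero}  {suc j} {suc n} f _         (s<s j<n) = +-monoʳ-≤ (f 0) (∑-≥-term (f ∘ suc) j<n)
∑-≥-pair {suc i} {suc j} {suc n} f (s<s i<j) (s<s j<n) = ≤-trans (∑-≥-pair (f ∘ suc) i<j j<n) (m≤n+m _ (f 0))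

∑-≥-triple : ∀ {i j k n} (f : ℕ → ℕ) → i < j → j < k → k < n → f i + f j + f k ≤ ∑[ l < n ] f l
∑-≥-triple {zero}  {suc j} {suc k} {suc n} f _ (s<s j<k) (s<s k<n) =
  ≤-trans (≤-reflexive (+-assoc (f 0) _ _)) (+-monoʳ-≤ (f 0) (∑-≥-pair (f ∘ suc) j<k k<n))
∑-≥-triple {suc i} {suc j} {suc k} {suc n} f (s<s i<j) (s<s j<k) (s<s k<n) =
  ≤-trans (∑-≥-triple (f ∘ suc) i<j j<k k<n) (m≤n+m _ (f 0))

[_]·_ : Dec A → ℕ → ℕ
[ yes _ ]· x = x
[ no  _ ]· x = 0

[]·-yes : ∀ {x} (a? : Dec A) → A → [ a? ]· x ≡ x
[]·-yes (yes _) _ = refl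
[]·-yes (no ¬a) a = contradiction a ¬a

[]·-no : ∀ {x} (a? : Dec A) → ¬ A → [ a? ]· x ≡ 0
[]·-no (yes a) ¬a = contradiction a ¬a
[]·-no (no _)  _  = refl

[]·-zero : (a? : Dec A) → [ a? ]· 0 ≡ 0
[]·-zero (yes _) = refl
[]·-zero (no _)  = refl

[]·-⇔ : ∀ {x} → (A → B) → (B → A) → (a? : Dec A) (b? : Dec B) → [ a? ]· x ≡ [ b? ]· x
[]·-⇔ to from (yes a) b? = sym ([]·-yes b? (to a))
[]·-⇔ to from (no ¬a) b? = sym ([]·-no b? (¬a ∘ from))

[]·-split : ∀ {x} (a? : Dec A) (b? : Dec B) → [ a? ]· x ≡ [ a? ×-dec ¬? b? ]· x + [ a? ×-dec b? ]· x
[]·-split (yes _) (yes _) = refl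
[]·-split (yes _) (no _)  = sym (+-identityʳ _)
[]·-split (no _)  _       = refl

sum-filter : ∀ {P : Pred ℕ p} (P? : Decidable P) xs →
             sum (filter P? xs) ≡ sum (map (λ x → [ P? x ]· x) xs)
sum-filter P? []       = refl
sum-filter P? (x ∷ xs) with P? x
... | yes _ = cong (x +_) (sum-filter P? xs)
... | no  _ = sum-filter P? xs

σ≡∑ : ∀ n → σ n ≡ ∑[ x < suc n ] [ x ∣? n ]· x
σ≡∑ n = begin
  sum (filter (_∣? n) (map suc (upTo n)))            ≡⟨ sum-filter (_∣? n) (map suc (upTo n)) ⟩
  sum (map term (map suc (upTo n)))                  ≡⟨ cong (sum ∘ map term) (map-upTo suc n) ⟩
  sum (map term (applyUpTo suc n))                   ≡⟨ cong sum (map-applyUpTo suc term n) ⟩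
  ∑[ i < n ] term (suc i)                            ≡⟨ cong (_+ ∑[ i < n ] term (suc i)) ([]·-zero (0 ∣? n)) ⟨
  ∑[ x < suc n ] term x                              ∎
  where
  open ≡-Reasoning
  term : ℕ → ℕ
  term x = [ x ∣? n ]· x

∑-divisors-bound : ∀ {P : Pred ℕ p} {n B} .{{_ : NonZero n}} (P? : Decidable P) →
                   (∀ {x} → P x → x ∣ n) → n < B → ∑[ x < B ] [ P? x ]· x ≡ ∑[ x < suc n ] [ P? x ]· x
∑-divisors-bound P? P⇒∣ = ∑-vanishing-tail (λ n<x → []·-no (P? _) (>⇒∤ n<x ∘ P⇒∣))

σ≡∑-bounded : ∀ {n B} .{{_ : NonZero n}} → n < B → σ n ≡ ∑[ x < B ] [ x ∣? n ]· x
σ≡∑-bounded {n} n<B = trans (σ≡∑ n) (sym (∑-divisors-bound (_∣? n) (λ x∣n → x∣n) n<B))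

m∣p*n∧p∤m⇒m∣n : ∀ {p m n} → Prime p → ¬ p ∣ m → m ∣ p * n → m ∣ n
m∣p*n∧p∤m⇒m∣n {p} {m} p-prime p∤m = coprime-divisor coprime
  where
  coprime : Coprime m p
  coprime (d∣m , d∣p) with prime⇒irreducible p-prime d∣p
  ... | inj₁ d≡1  = d≡1
  ... | inj₂ refl = contradiction d∣m p∤m

prime⇒>1 : ∀ {p} → Prime p → 1 < p
prime⇒>1 {p} p-prime = nonTrivial⇒n>1 p {{prime⇒nonTrivial p-prime}}

σ∤ : ℕ → ℕ → ℕ
σ∤ q n = ∑[ x < suc n ] [ x ∣? n ×-dec ¬? (q ∣? x) ]· x

σ∤-indivisible : ∀ {q n} → ¬ q ∣ n → σ∤ q n ≡ σ n
σ∤-indivisible {q} {n} q∤n = begin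
  σ∤ q n                        ≡⟨ ∑-cong (suc n) {g = λ x → [ x ∣? n ]· x} same-term ⟩
  ∑[ x < suc n ] [ x ∣? n ]· x  ≡⟨ σ≡∑ n ⟨
  σ n                           ∎
  where
  open ≡-Reasoning
  same-term : ∀ x → [ x ∣? n ×-dec ¬? (q ∣? x) ]· x ≡ [ x ∣? n ]· x
  same-term x = []·-⇔ proj₁ (λ x∣n → x∣n , q∤n ∘ flip ∣-trans x∣n)
                            (x ∣? n ×-dec ¬? (q ∣? x)) (x ∣? n)

∑-divisible-divisors-* : ∀ q n .{{_ : NonZero q}} →
  ∑[ x < suc n * q ] [ x ∣? q * n ×-dec q ∣? x ]· x ≡ q * σ n
∑-divisible-divisors-* q n = begin
  ∑[ x < suc n * q ] [ x ∣? q * n ×-dec q ∣? x ]· x            ≡⟨ ∑-multiples (suc n) q off-multiples ⟩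
  ∑[ j < suc n ] [ j * q ∣? q * n ×-dec q ∣? j * q ]· (j * q)  ≡⟨ ∑-cong (suc n) multiple-term ⟩
  ∑[ j < suc n ] (q * [ j ∣? n ]· j)                           ≡⟨ *-distribˡ-∑ (suc n) q (λ j → [ j ∣? n ]· j) ⟨
  q * ∑[ j < suc n ] [ j ∣? n ]· j                             ≡⟨ cong (q *_) (σ≡∑ n) ⟨
  q * σ n                                                      ∎
  where
  open ≡-Reasoning
  off-multiples : ∀ {x} → ¬ q ∣ x → [ x ∣? q * n ×-dec q ∣? x ]· x ≡ 0
  off-multiples {x} q∤x = []·-no (x ∣? q * n ×-dec q ∣? x) (q∤x ∘ proj₂)
  multiple-term : ∀ j → [ j * q ∣? q * n ×-dec q ∣? j * q ]· (j * q) ≡ q * [ j ∣? n ]· j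
  multiple-term j with j ∣? n
  ... | yes j∣n = trans ([]·-yes (j * q ∣? q * n ×-dec q ∣? j * q) (jq∣qn , n∣m*n j)) (*-comm j q)
    where jq∣qn = subst (j * q ∣_) (*-comm n q) (*-monoˡ-∣ q j∣n)
  ... | no  j∤n = trans ([]·-no (j * q ∣? q * n ×-dec q ∣? j * q) (j∤n ∘ cancel ∘ proj₁)) (sym (*-zeroʳ q))
    where cancel = *-cancelʳ-∣ q ∘ subst (j * q ∣_) (*-comm q n)

module _ {q : ℕ} (q-prime : Prime q) where

  private
    instance
      q≢0 : NonZero q
      q≢0 = prime⇒nonZero q-prime

    q^a*r≢0 : ∀ a {r} → ¬ q ∣ r → NonZero (q ^ a * r)
    q^a*r≢0 a {zero}  q∤0 = contradiction (q ∣0) q∤0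
    q^a*r≢0 a {suc r} _   = m*n≢0 (q ^ a) (suc r) {{m^n≢0 q a}}

    q∤1 : ¬ q ∣ 1
    q∤1 q∣1 = <⇒≢ (prime⇒>1 q-prime) (sym (∣1⇒≡1 q∣1))

  ∑-indivisible-divisors-* : ∀ {n B} .{{_ : NonZero n}} → n < B →
    ∑[ x < B ] [ x ∣? q * n ×-dec ¬? (q ∣? x) ]· x ≡ σ∤ q n
  ∑-indivisible-divisors-* {n} {B} n<B = begin
    ∑[ x < B ] [ x ∣? q * n ×-dec ¬? (q ∣? x) ]· x  ≡⟨ ∑-cong B same-term ⟩
    ∑[ x < B ] [ x ∣? n ×-dec ¬? (q ∣? x) ]· x      ≡⟨ ∑-divisors-bound (λ x → x ∣? n ×-dec ¬? (q ∣? x)) proj₁ n<B ⟩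
    σ∤ q n                                          ∎
    where
    open ≡-Reasoning
    to : ∀ {x} → x ∣ q * n × ¬ q ∣ x → x ∣ n × ¬ q ∣ x
    to (x∣qn , q∤x) = m∣p*n∧p∤m⇒m∣n q-prime q∤x x∣qn , q∤x
    from : ∀ {x} → x ∣ n × ¬ q ∣ x → x ∣ q * n × ¬ q ∣ x
    from (x∣n , q∤x) = ∣-trans x∣n (n∣m*n q) , q∤x
    same-term : ∀ x → [ x ∣? q * n ×-dec ¬? (q ∣? x) ]· x ≡ [ x ∣? n ×-dec ¬? (q ∣? x) ]· x
    same-term x = []·-⇔ to from (x ∣? q * n ×-dec ¬? (q ∣? x)) (x ∣? n ×-dec ¬? (q ∣? x))

  σ∤-* : ∀ {n} .{{_ : NonZero n}} → σ∤ q (q * n) ≡ σ∤ q n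
  σ∤-* {n} = ∑-indivisible-divisors-* (s≤s (m≤n*m n q))

  -- Split the divisors of q * n by whether q divides them: those that do are q times the divisors of n,
  -- and, q being prime, those that do not are the divisors of n not divisible by q.
  σ-* : ∀ {n} .{{_ : NonZero n}} → σ (q * n) ≡ σ∤ q n + q * σ n
  σ-* {n} = begin
    σ (q * n)
      ≡⟨ σ≡∑-bounded {{m*n≢0 q n}} (subst (_< N) (*-comm n q) (*-monoˡ-< q (n<1+n n))) ⟩
    ∑[ x < N ] [ x ∣? q * n ]· x
      ≡⟨ ∑-cong N (λ x → []·-split (x ∣? q * n) (q ∣? x)) ⟩
    ∑[ x < N ] ([ x ∣? q * n ×-dec ¬? (q ∣? x) ]· x + [ x ∣? q * n ×-dec q ∣? x ]· x)
      ≡⟨ ∑-distrib-+ N _ _ ⟩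
    ∑[ x < N ] [ x ∣? q * n ×-dec ¬? (q ∣? x) ]· x + ∑[ x < N ] [ x ∣? q * n ×-dec q ∣? x ]· x
      ≡⟨ cong₂ _+_ (∑-indivisible-divisors-* n<N) (∑-divisible-divisors-* q n) ⟩
    σ∤ q n + q * σ n
      ∎
    where
    open ≡-Reasoning
    N = suc n * q
    n<N : n < N
    n<N = <-≤-trans (n<1+n n) (m≤m*n (suc n) q)

  σ∤-prime-power : ∀ a {r} → ¬ q ∣ r → σ∤ q (q ^ a * r) ≡ σ r
  σ∤-prime-power zero    {r} q∤r = trans (cong (σ∤ q) (*-identityˡ r)) (σ∤-indivisible q∤r)
  σ∤-prime-power (suc a) {r} q∤r = begin
    σ∤ q (q * q ^ a * r)   ≡⟨ cong (σ∤ q) (*-assoc q (q ^ a) r) ⟩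
    σ∤ q (q * (q ^ a * r)) ≡⟨ σ∤-* {{q^a*r≢0 a q∤r}} ⟩
    σ∤ q (q ^ a * r)       ≡⟨ σ∤-prime-power a q∤r ⟩
    σ r                    ∎
    where open ≡-Reasoning

  σ-prime-power-suc-* : ∀ a {r} → ¬ q ∣ r → σ (q ^ suc a * r) ≡ σ r + q * σ (q ^ a * r)
  σ-prime-power-suc-* a {r} q∤r = begin
    σ (q * q ^ a * r)                    ≡⟨ cong σ (*-assoc q (q ^ a) r) ⟩
    σ (q * (q ^ a * r))                  ≡⟨ σ-* {{q^a*r≢0 a q∤r}} ⟩
    σ∤ q (q ^ a * r) + q * σ (q ^ a * r) ≡⟨ cong (_+ q * σ (q ^ a * r)) (σ∤-prime-power a q∤r) ⟩
    σ r + q * σ (q ^ a * r)              ∎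
    where open ≡-Reasoning

  σ-prime-power-suc : ∀ a → σ (q ^ suc a) ≡ 1 + q * σ (q ^ a)
  σ-prime-power-suc a = begin
    σ (q ^ suc a)          ≡⟨ cong σ (*-identityʳ (q ^ suc a)) ⟨
    σ (q ^ suc a * 1)      ≡⟨ σ-prime-power-suc-* a q∤1 ⟩
    1 + q * σ (q ^ a * 1)  ≡⟨ cong (λ m → 1 + q * σ m) (*-identityʳ (q ^ a)) ⟩
    1 + q * σ (q ^ a)      ∎
    where open ≡-Reasoning

  σ-prime : σ q ≡ 1 + q
  σ-prime = begin
    σ q        ≡⟨ cong σ (*-identityʳ q) ⟨
    σ (q ^ 1)  ≡⟨ σ-prime-power-suc 0 ⟩
    1 + q * 1  ≡⟨ cong (1 +_) (*-identityʳ q) ⟩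
    1 + q      ∎
    where open ≡-Reasoning

  σ-prime-power-* : ∀ a {r} → ¬ q ∣ r → σ (q ^ a * r) ≡ σ (q ^ a) * σ r
  σ-prime-power-* zero    {r} q∤r = trans (cong σ (*-identityˡ r)) (sym (*-identityˡ (σ r)))
  σ-prime-power-* (suc a) {r} q∤r = begin
    σ (q ^ suc a * r)              ≡⟨ σ-prime-power-suc-* a q∤r ⟩
    σ r + q * σ (q ^ a * r)        ≡⟨ cong (λ m → σ r + q * m) (σ-prime-power-* a q∤r) ⟩
    σ r + q * (σ (q ^ a) * σ r)    ≡⟨ cong₂ _+_ (*-identityˡ (σ r)) (*-assoc q (σ (q ^ a)) (σ r)) ⟨
    1 * σ r + q * σ (q ^ a) * σ r  ≡⟨ *-distribʳ-+ (σ r) 1 (q * σ (q ^ a)) ⟨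
    (1 + q * σ (q ^ a)) * σ r      ≡⟨ cong (_* σ r) (σ-prime-power-suc a) ⟨
    σ (q ^ suc a) * σ r            ∎
    where open ≡-Reasoning

  prime-power-deficient : ∀ a → σ (q ^ a) < 2 * q ^ a
  prime-power-deficient zero    = s≤s (s≤s z≤n)
  prime-power-deficient (suc a) = begin-strict
    σ (q ^ suc a)        ≡⟨ σ-prime-power-suc a ⟩
    1 + q * σ (q ^ a)    <⟨ +-monoˡ-< (q * σ (q ^ a)) (prime⇒>1 q-prime) ⟩
    q + q * σ (q ^ a)    ≡⟨ *-suc q (σ (q ^ a)) ⟨
    q * suc (σ (q ^ a))  ≤⟨ *-monoʳ-≤ q (prime-power-deficient a) ⟩
    q * (2 * q ^ a)      ≡⟨ x∙yz≈y∙xz q 2 (q ^ a) ⟩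
    2 * q ^ suc a        ∎
    where open ≤-Reasoning

σ-≥-1+n : ∀ {n} → 1 < n → 1 + n ≤ σ n
σ-≥-1+n {n} n>1 = begin
  1 + n                                  ≡⟨ cong₂ _+_ ([]·-yes (1 ∣? n) (1∣ n)) ([]·-yes (n ∣? n) ∣-refl) ⟨
  [ 1 ∣? n ]· 1 + [ n ∣? n ]· n          ≤⟨ ∑-≥-pair (λ x → [ x ∣? n ]· x) n>1 (n<1+n n) ⟩
  ∑[ x < suc n ] [ x ∣? n ]· x           ≡⟨ σ≡∑ n ⟨
  σ n                                    ∎
  where open ≤-Reasoning

σ-≥-1+d+n : ∀ {d n} → 1 < d → d < n → d ∣ n → 1 + d + n ≤ σ n
σ-≥-1+d+n {d} {n} d>1 d<n d∣n = begin
  1 + d + n                                     ≡⟨ cong₂ _+_ (cong₂ _+_ ([]·-yes (1 ∣? n) (1∣ n)) ([]·-yes (d ∣? n) d∣n))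
                                                              ([]·-yes (n ∣? n) ∣-refl) ⟨
  [ 1 ∣? n ]· 1 + [ d ∣? n ]· d + [ n ∣? n ]· n ≤⟨ ∑-≥-triple (λ x → [ x ∣? n ]· x) d>1 d<n (n<1+n n) ⟩
  ∑[ x < suc n ] [ x ∣? n ]· x                  ≡⟨ σ≡∑ n ⟨
  σ n                                           ∎
  where open ≤-Reasoning

∃-prime-divisor : ∀ {n} → 1 < n → ∃[ p ] (Prime p × p ∣ n)
∃-prime-divisor {n} n>1 with factorise n {{>-nonZero (<-trans z<s n>1)}}
... | record { factors = [] ; isFactorisation = n≡1 } = contradiction n≡1 (>⇒≢ n>1)
... | record { factors = p ∷ ps ; isFactorisation = n≡p*Πps ; factorsPrime = p-prime All.∷ _ } =
  p , p-prime , divides (product ps) (trans n≡p*Πps (*-comm p (product ps)))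

prime-power-part : ∀ {q} → 1 < q → ∀ n → .{{NonZero n}} → ∃[ a ] ∃[ r ] (n ≡ q ^ a * r × ¬ q ∣ r)
prime-power-part {q} q>1 n = go n (<-wellFounded n)
  where
  instance _ = n>1⇒nonTrivial q>1
  go : ∀ n → Acc _<_ n → .{{NonZero n}} → ∃[ a ] ∃[ r ] (n ≡ q ^ a * r × ¬ q ∣ r)
  go n (acc rec) with q ∣? n
  ... | no q∤n  = 0 , n , sym (*-identityˡ n) , q∤n
  ... | yes q∣n with go (quotient q∣n) (rec (quotient-< q∣n)) {{quotient≢0 q∣n}}
  ...   | a , r , n/q≡q^a*r , q∤r =
    suc a , r , trans (m∣n⇒n≡m*quotient q∣n) (trans (cong (q *_) n/q≡q^a*r) (sym (*-assoc q (q ^ a) r))) , q∤r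

*-composite : ∀ {a b} → 1 < a → 1 < b → Composite (a * b)
*-composite {a} {b} a>1 b>1 = hasNonTrivialDivisor {{n>1⇒nonTrivial a>1}} (m<m*n a b {{a≢0}} b>1) (m∣m*n b)
  where a≢0 = >-nonZero (<-trans z<s a>1)

σ>1⇒n>1 : ∀ n → 1 < σ n → 1 < n
σ>1⇒n>1 1      (s<s ())
σ>1⇒n>1 (2+ _) _ = s<s z<s

n>1⇒σ>1 : ∀ n → 1 < n → 1 < σ n
n>1⇒σ>1 n n>1 = <-≤-trans n>1 (≤-trans (n≤1+n n) (σ-≥-1+n n>1))

prime-σ⇒prime-power : ∀ n → Prime (σ n) → ∃[ q ] ∃[ a ] (Prime q × n ≡ q ^ a)
prime-σ⇒prime-power n σn-prime = split-off (∃-prime-divisor n>1)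
  where
  n>1 : 1 < n
  n>1 = σ>1⇒n>1 n (prime⇒>1 σn-prime)
  instance
    n≢0 : NonZero n
    n≢0 = >-nonZero (<-trans z<s n>1)
  split-off : ∃[ q ] (Prime q × q ∣ n) → ∃[ q ] ∃[ a ] (Prime q × n ≡ q ^ a)
  split-off (q , q-prime , q∣n) with prime-power-part (prime⇒>1 q-prime) n
  ... | zero  , r        , n≡1*r   , q∤r = contradiction (subst (q ∣_) (trans n≡1*r (*-identityˡ r)) q∣n) q∤r
  ... | suc a , 0        , _       , q∤0 = contradiction (q ∣0) q∤0
  ... | suc a , 1        , n≡q^a*1 , _   = q , suc a , q-prime , trans n≡q^a*1 (*-identityʳ _)
  ... | suc a , r@(2+ _) , n≡q^a*r , q∤r =
    contradiction σn-prime (composite⇒¬prime (subst Composite (sym σn≡) σn-composite))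
    where
    σn≡ : σ n ≡ σ (q ^ suc a) * σ r
    σn≡ = trans (cong σ n≡q^a*r) (σ-prime-power-* q-prime (suc a) q∤r)
    q^a>1 : 1 < q ^ suc a
    q^a>1 = ^-monoʳ-< q (prime⇒>1 q-prime) {0} {suc a} z<s
    σn-composite : Composite (σ (q ^ suc a) * σ r)
    σn-composite = *-composite (n>1⇒σ>1 (q ^ suc a) q^a>1) (n>1⇒σ>1 r (s<s z<s))

prime-σ⇒σσ≤2n : ∀ n → Prime (σ n) → σ (σ n) ≤ 2 * n
prime-σ⇒σσ≤2n n σn-prime with prime-σ⇒prime-power n σn-prime
... | q , a , q-prime , refl = subst (_≤ 2 * q ^ a) (sym (σ-prime σn-prime)) (prime-power-deficient q-prime a)

composite⇒≤square : ∀ {m k} → Composite m → σ m ≤ m + k → m ≤ k * k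
composite⇒≤square {m} {k} (hasNonTrivialDivisor {b} b<m b∣m) σm≤m+k = begin
  m                ≡⟨ m∣n⇒n≡quotient*m b∣m ⟩
  quotient b∣m * b ≤⟨ *-mono-≤ (<⇒≤ (divisor<k c>1 c<m (quotient-∣ b∣m))) (<⇒≤ (divisor<k b>1 b<m b∣m)) ⟩
  k * k            ∎
  where
  open ≤-Reasoning
  b>1 = nonTrivial⇒n>1 b
  instance m≢0 = >-nonZero (<-trans z<s (<-trans b>1 b<m))
  c>1 = quotient>1 b∣m b<m
  c<m = quotient-< b∣m
  divisor<k : ∀ {c} → 1 < c → c < m → c ∣ m → c < k
  divisor<k {c} c>1 c<m c∣m = +-cancelʳ-≤ m (1 + c) k (begin
    1 + c + m ≤⟨ σ-≥-1+d+n c>1 c<m c∣m ⟩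
    σ m       ≤⟨ σm≤m+k ⟩
    m + k     ≡⟨ +-comm m k ⟩
    k + m     ∎)

square-of-odd : ∀ k → 4 * (k * k + k) + 1 ≡ (2 * k + 1) * (2 * k + 1)
square-of-odd = solve-∀

square-bound : ∀ n {m k} → 3 * n ≡ m + k → m ≤ k * k → 12 * n + 1 ≤ (2 * k + 1) ^ 2
square-bound n {m} {k} 3n≡m+k m≤k*k = begin
  12 * n + 1                 ≡⟨ cong (_+ 1) (trans (*-assoc 4 3 n) (cong (4 *_) 3n≡m+k)) ⟩
  4 * (m + k) + 1            ≤⟨ +-monoˡ-≤ 1 (*-monoʳ-≤ 4 (+-monoˡ-≤ k m≤k*k)) ⟩
  4 * (k * k + k) + 1        ≡⟨ square-of-odd k ⟩
  (2 * k + 1) * (2 * k + 1)  ≡⟨ cong ((2 * k + 1) *_) (*-identityʳ (2 * k + 1)) ⟨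
  (2 * k + 1) ^ 2            ∎
  where open ≤-Reasoning

mainTheorem16 : (n : ℕ) → 0 < n → NearSuperperfect n →
    σ n ≤ 3 * n × 12 * n + 1 ≤ (2 * (3 * n ∸ σ n) + 1) ^ 2
mainTheorem16 n 0<n (d , 0<d , d∣n , 2n+d≡σm) =
  m≤3n , square-bound n 3n≡m+k (composite⇒≤square m-composite σm≤m+k)
  where
  m = σ n
  k = 3 * n ∸ m
  2n<σm : 2 * n < σ m
  2n<σm = subst (2 * n <_) 2n+d≡σm (m<m+n (2 * n) 0<d)
  σm≤3n : σ m ≤ 3 * n
  σm≤3n = subst (_≤ 3 * n) 2n+d≡σm (≤-trans (+-monoʳ-≤ (2 * n) d≤n) (≤-reflexive (+-comm (2 * n) n)))
    where d≤n = ∣⇒≤ {{>-nonZero 0<n}} d∣n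
  m>1 : 1 < m
  m>1 = σ>1⇒n>1 m (≤-<-trans (≤-trans 0<n (m≤m+n n (1 * n))) 2n<σm)
  m-composite : Composite m
  m-composite = ¬prime⇒composite {{n>1⇒nonTrivial m>1}} (λ m-prime → <⇒≱ 2n<σm (prime-σ⇒σσ≤2n n m-prime))
  m≤3n : m ≤ 3 * n
  m≤3n = ≤-trans (n≤1+n m) (≤-trans (σ-≥-1+n m>1) σm≤3n)
  3n≡m+k : 3 * n ≡ m + k
  3n≡m+k = sym (m+[n∸m]≡n m≤3n)
  σm≤m+k : σ m ≤ m + k
  σm≤m+k = subst (σ m ≤_) 3n≡m+k σm≤3n
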